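{- Let $k,r\in\mathbb{N}$ and let $M_1,\ldots,M_k$ be matchings in a common simple undirected graph such that the graph formed by the union of their edge sets has maximum degree at most $r$. Suppose $e(M_i)>2(r^3+r)^2\ln k$ for all $i \in [k]$. Then there exists a matching $H\subseteq \bigcup_{i \in [k]}M_i$ with $|E(H)\cap M_i|\geq e(M_i)/(r^2+1)$ for all $i \in [k]$.
   Context: A matching is a set of edges no two of which share a vertex; $e(M)$ denotes the number of edges of $M$. -}

module Defs where

open import Data.Nat using (ℕ; zero; suc; _+_; _*_; _^_; _≤_; _<_; _!)
open import Data.Fin using (Fin; toℕ)
open import Data.Fin.Properties using (_≟_)
open import Data.Product using (_×_; _,_; ∃-syntax)
open import Data.Product.Properties using (≡-dec)
open import Data.List using (List; length; filter; concat; map)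
open import Data.List.Relation.Unary.All using (All)
open import Data.List.Relation.Unary.AllPairs using (AllPairs)
open import Data.List.Relation.Unary.Unique.Propositional using (Unique)
open import Data.List.Membership.Propositional using (_∈_)
open import Data.Vec.Functional using (Vector; toList)
open import Relation.Binary.PropositionalEquality using (_≡_; _≢_)
open import Relation.Binary.Definitions using (DecidableEquality)
import Data.List.Membership.DecPropositional as DecMem
open import Data.Sum using (_⊎_)

-- A (potential) edge of a simple graph on vertex set Fin n, written as an
-- ordered pair (u , v); a genuine edge must satisfy toℕ u < toℕ v, so each
-- unordered pair {u , v} (u ≠ v) has exactly one representation.
Edge : ℕ → Set
Edge n = Fin n × Fin n

ValidEdge : ∀ {n} → Edge n → Set
ValidEdge (u , v) = toℕ u < toℕ v

_≟ₑ_ : ∀ {n} → DecidableEquality (Edge n)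
_≟ₑ_ = ≡-dec _≟_ _≟_

Incident : ∀ {n} → Fin n → Edge n → Set
Incident x (u , v) = (x ≡ u) ⊎ (x ≡ v)

VertexDisjoint : ∀ {n} → Edge n → Edge n → Set
VertexDisjoint (u , v) (u' , v') = u ≢ u' × u ≢ v' × v ≢ u' × v ≢ v'

IsMatching : ∀ {n} → List (Edge n) → Set
IsMatching M = All ValidEdge M × AllPairs VertexDisjoint M

e : ∀ {n} → List (Edge n) → ℕ
e M = length M

-- Edge list of the union of the M i (possibly with repetitions).
⋃ : ∀ {n k} → Vector (List (Edge n)) k → List (Edge n)
⋃ M = concat (toList M)

-- The graph with edge set E has maximum degree at most r: for every vertex x,
-- any collection of distinct edges of E incident to x has at most r elements,
-- i.e. |{ f ∈ E : x ∈ f }| ≤ r.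
MaxDegreeAtMost : ∀ {n} → List (Edge n) → ℕ → Set
MaxDegreeAtMost {n} E r =
  (x : Fin n) (L : List (Edge n)) → Unique L →
  All (λ f → f ∈ E × Incident x f) L → length L ≤ r

-- |E(H) ∩ M| for a matching H (whose edges are distinct)
∣_∩_∣ : ∀ {n} → List (Edge n) → List (Edge n) → ℕ
∣ H ∩ M ∣ = length (filter (λ f → f ∈? M) H)
  where open DecMem _≟ₑ_ using (_∈?_)

-- expSum m N = Σ_{j=0}^{N} m^j · N!/j!   ( = N! · Σ_{j≤N} m^j / j! )
expSum : ℕ → ℕ → ℕ
expSum m zero = 1
expSum m (suc N) = suc N * expSum m N + m ^ suc N

-- LnBound m c k  encodes the real inequality  m > c · ln k  (for k ≥ 1):
-- it holds iff e^m > k^c iff some partial sum Σ_{j≤N} m^j/j! exceeds k^c,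
-- i.e. k^c · N! < expSum m N for some N.
LnBound : ℕ → ℕ → ℕ → Set
LnBound m c k = ∃[ N ] (k ^ c * N ! < expSum m N)

{-# OPTIONS --safe #-}
-- Every vertex numbers its at most r incident edges and picks one of r numbers uniformly at
-- random; an edge survives if both of its endpoints pick its number.  The survivors form a
-- matching, every edge survives with probability 1/r², and the edges of one matching Mᵢ
-- survive independently.  Weighting an edge by r⁴ if it survives and by r²(r² + 1) otherwise,
-- the product of the weights over Mᵢ has expectation (r⁴ + r² - 1)^e(Mᵢ) but is large whenever
-- fewer than e(Mᵢ)/(r² + 1) edges of Mᵢ survive; once e(Mᵢ) > 2(r³ + r)² ln k, Markov's
-- inequality bounds the probability of this by less than 1/k.  So the normalised sum over i of
-- these products has expectation below its value on any outcome that is bad for some i, and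
-- fixing the choices vertex by vertex without increasing the conditional expectation of this
-- sum yields an outcome that is bad for no i.
module Submission where

open import Defs
open import Data.Nat using (ℕ; _+_; _*_; _^_; _≤_)
open import Data.Fin using (Fin)
open import Data.Product using (_×_; ∃-syntax)
open import Data.List using (List)
open import Data.List.Relation.Unary.All using (All)
open import Data.List.Membership.Propositional using (_∈_)
open import Data.Vec.Functional using (Vector)

open import Data.Nat
open import Data.Nat.Properties
open import Data.Nat.ListAction using (product)
open import Data.Nat.Tactic.RingSolver using (solve-∀)
open import Data.Bool using (Bool; true; false; if_then_else_; T; _∧_)
open import Data.Bool.Properties using (T-∧)
open import Data.Fin using (toℕ)
import Data.Fin as Fin
open import Data.Fin.Properties using (toℕ<n; toℕ-injective) renaming (_≟_ to _≟ᶠ_)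
open import Data.Product using (_,_; proj₁; proj₂)
open import Data.Sum using (_⊎_; inj₁; inj₂)
open import Data.List using ([]; _∷_; length; map; filter; deduplicate)
open import Data.List.Properties using (map-cong)
open import Data.List.Relation.Unary.All as All using ([]; _∷_)
open import Data.List.Relation.Unary.AllPairs as AllPairs using (AllPairs; []; _∷_)
open import Data.List.Relation.Unary.Any using (here; there; index)
open import Data.List.Relation.Unary.Any.Properties using (tabulate⁻)
open import Data.List.Relation.Unary.Unique.Propositional using (Unique)
import Data.List.Relation.Unary.Unique.Propositional.Properties as Unique
open import Data.List.Relation.Unary.Unique.DecPropositional.Properties using (deduplicate-!)
open import Data.List.Membership.Propositional.Properties
  using (∈-filter⁺; ∈-filter⁻; ∈-deduplicate⁺; ∈-deduplicate⁻; ∈-concat⁻; ∈-concat⁺′; ∈-tabulate⁺)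
open import Data.List.Membership.Setoid.Properties using (index-injective)
open import Data.Vec.Functional using (toList)
open import Function using (_∘_)
open import Function.Bundles using (Equivalence)
open import Relation.Nullary using (¬_; yes; no; does; contradiction)
open import Relation.Nullary.Decidable using (_⊎-dec_; T?)
open import Relation.Unary using (Decidable)
open import Relation.Unary.Properties using (∁?)
open import Relation.Binary.PropositionalEquality
open import Algebra.Properties.CommutativeSemigroup *-commutativeSemigroup using (x∙yz≈y∙xz)
open import Algebra.Properties.Semiring.Sum +-*-semiring
  using (sum; sum-syntax; sum-cong-≗; sum-remove; ∑-comm; ∑-distrib-+; *-distribˡ-sum; *-distribʳ-sum)

^-distribʳ-* : ∀ m n o → (m * n) ^ o ≡ m ^ o * n ^ o
^-distribʳ-* m n zero    = refl
^-distribʳ-* m n (suc o) =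
  trans (cong (m * n *_) (^-distribʳ-* m n o)) (shuffle m n (m ^ o) (n ^ o))
  where
  shuffle : ∀ a b x y → a * b * (x * y) ≡ a * x * (b * y)
  shuffle = solve-∀

^-cancelˡ-< : ∀ o {m n} → m ^ o < n ^ o → m < n
^-cancelˡ-< o mᵒ<nᵒ = ≰⇒> (λ n≤m → <⇒≱ mᵒ<nᵒ (^-monoˡ-≤ o n≤m))

^-comm : ∀ x a b → (x ^ a) ^ b ≡ (x ^ b) ^ a
^-comm x a b = trans (^-*-assoc x a b) (trans (cong (x ^_) (*-comm a b)) (sym (^-*-assoc x b a)))

^-exchange-≤ : ∀ {x y i j} → x ≤ y → i ≤ j → y ^ i * x ^ j ≤ x ^ i * y ^ j
^-exchange-≤ {x} {y} {i} {j} x≤y i≤j = begin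
  y ^ i * x ^ j             ≡⟨ cong (λ e → y ^ i * x ^ e) (m+[n∸m]≡n i≤j) ⟨
  y ^ i * x ^ (i + d)       ≡⟨ cong (y ^ i *_) (^-distribˡ-+-* x i d) ⟩
  y ^ i * (x ^ i * x ^ d)   ≡⟨ x∙yz≈y∙xz (y ^ i) (x ^ i) (x ^ d) ⟩
  x ^ i * (y ^ i * x ^ d)   ≤⟨ *-monoʳ-≤ (x ^ i) (*-monoʳ-≤ (y ^ i) (^-monoˡ-≤ d x≤y)) ⟩
  x ^ i * (y ^ i * y ^ d)   ≡⟨ cong (x ^ i *_) (^-distribˡ-+-* y i d) ⟨
  x ^ i * y ^ (i + d)       ≡⟨ cong (λ e → x ^ i * y ^ e) (m+[n∸m]≡n i≤j) ⟩
  x ^ i * y ^ j             ∎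
  where
  open ≤-Reasoning
  d = j ∸ i

rising : ℕ → ℕ → ℕ
rising L zero    = 1
rising L (suc j) = rising L j * (L + j)

rising-suc : ∀ L j → rising L (suc j) ≡ L * rising (suc L) j
rising-suc L zero    = base L
  where
  base : ∀ L → 1 * (L + 0) ≡ L * 1
  base = solve-∀
rising-suc L (suc j) rewrite rising-suc L j = reassoc L j (rising (suc L) j)
  where
  reassoc : ∀ L j x → L * x * (L + suc j) ≡ L * (x * (suc L + j))
  reassoc = solve-∀

rising-pascal : ∀ L j → rising (suc L) (suc j) ≡ rising L (suc j) + suc j * rising (suc L) j
rising-pascal L j rewrite rising-suc L j = split L j (rising (suc L) j)
  where
  split : ∀ L j x → x * (suc L + j) ≡ L * x + suc j * x
  split = solve-∀

^≤rising : ∀ L j → L ^ j ≤ rising L j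
^≤rising L zero    = ≤-refl
^≤rising L (suc j) rewrite *-comm L (L ^ j) = *-mono-≤ (^≤rising L j) (m≤m+n L j)

-- negBinSum c L N = N! c^N Σ_{j ≤ N} rising L j / (j! c^j), a partial sum of the
-- negative binomial series (1 - 1/c)^(-L) = Σ_j binom(L + j - 1, j) c^(-j).
negBinSum : ℕ → ℕ → ℕ → ℕ
negBinSum c L zero    = 1
negBinSum c L (suc N) = suc N * c * negBinSum c L N + rising L (suc N)

negBinSum-step : ∀ c L N →
  c * negBinSum c (suc L) N + rising (suc L) N ≡ c * negBinSum c L N + negBinSum c (suc L) N
negBinSum-step c L zero    = refl
negBinSum-step c L (suc N) = begin
  c * (sN * c * a + z) + z                       ≡⟨ cong (λ w → c * (sN * c * a + w) + w) (rising-pascal L N) ⟩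
  c * (sN * c * a + (y + sN * x)) + (y + sN * x) ≡⟨ collect c sN a x y ⟩
  c * sN * (c * a + x) + c * y + (y + sN * x)    ≡⟨ cong (λ w → c * sN * w + c * y + (y + sN * x)) (negBinSum-step c L N) ⟩
  c * sN * (c * b + a) + c * y + (y + sN * x)    ≡⟨ spread c sN a b x y ⟩
  c * (sN * c * b + y) + (sN * c * a + (y + sN * x)) ≡⟨ cong (λ w → c * (sN * c * b + y) + (sN * c * a + w)) (rising-pascal L N) ⟨
  c * (sN * c * b + y) + (sN * c * a + z)        ∎
  where
  open ≡-Reasoning
  sN = suc N
  a = negBinSum c (suc L) N
  b = negBinSum c L N
  x = rising (suc L) N
  y = rising L (suc N)
  z = rising (suc L) (suc N)
  collect : ∀ c sN a x y → c * (sN * c * a + (y + sN * x)) + (y + sN * x) ≡ c * sN * (c * a + x) + c * y + (y + sN * x)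
  collect = solve-∀
  spread : ∀ c sN a b x y → c * sN * (c * b + a) + c * y + (y + sN * x) ≡ c * (sN * c * b + y) + (sN * c * a + (y + sN * x))
  spread = solve-∀

negBinSum-pascal : ∀ c L N →
  negBinSum c (suc L) (suc N) ≡ negBinSum c L (suc N) + suc N * negBinSum c (suc L) N
negBinSum-pascal c L N = begin
  sN * c * a + z                  ≡⟨ cong (sN * c * a +_) (rising-pascal L N) ⟩
  sN * c * a + (y + sN * x)       ≡⟨ collect c sN a x y ⟩
  sN * (c * a + x) + y            ≡⟨ cong (λ w → sN * w + y) (negBinSum-step c L N) ⟩
  sN * (c * b + a) + y            ≡⟨ spread c sN a b y ⟩
  (sN * c * b + y) + sN * a       ∎
  where
  open ≡-Reasoning
  sN = suc N
  a = negBinSum c (suc L) N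
  b = negBinSum c L N
  x = rising (suc L) N
  y = rising L (suc N)
  z = rising (suc L) (suc N)
  collect : ∀ c sN a x y → sN * c * a + (y + sN * x) ≡ sN * (c * a + x) + y
  collect = solve-∀
  spread : ∀ c sN a b y → sN * (c * b + a) + y ≡ (sN * c * b + y) + sN * a
  spread = solve-∀

negBinSum-zero : ∀ c N → negBinSum c 0 N ≡ N ! * c ^ N
negBinSum-zero c zero    = refl
negBinSum-zero c (suc N) rewrite rising-suc 0 N | negBinSum-zero c N = reassoc (suc N) c (N !) (c ^ N)
  where
  reassoc : ∀ n c f p → n * c * (f * p) + 0 ≡ n * f * (c * p)
  reassoc = solve-∀

-- (1 - 1/c)^(-L) bounds its partial sums.
negBinSum-bound : ∀ c′ L N → negBinSum (suc c′) L N * c′ ^ L ≤ N ! * suc c′ ^ (N + L)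
negBinSum-bound c′ zero N rewrite negBinSum-zero (suc c′) N | +-identityʳ N = ≤-reflexive (*-identityʳ _)
negBinSum-bound c′ (suc L) zero = +-mono-≤ (^-monoˡ-≤ (suc L) (n≤1+n c′)) z≤n
negBinSum-bound c′ (suc L) (suc N) = begin
  negBinSum c (suc L) (suc N) * c′ ^ suc L
    ≡⟨ cong (_* c′ ^ suc L) (negBinSum-pascal c L N) ⟩
  (a + suc N * b) * (c′ * c′ ^ L)
    ≡⟨ distribute a (suc N) b c′ (c′ ^ L) ⟩
  (a * c′ ^ L) * c′ + suc N * (b * c′ ^ suc L)
    ≤⟨ +-mono-≤ (*-monoˡ-≤ c′ (negBinSum-bound c′ L (suc N))) (*-monoʳ-≤ (suc N) (negBinSum-bound c′ (suc L) N)) ⟩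
  (suc N ! * c ^ (suc N + L)) * c′ + suc N * (N ! * c ^ (N + suc L))
    ≡⟨ cong (λ w → (suc N ! * c ^ (suc N + L)) * c′ + suc N * (N ! * c ^ w)) (+-suc N L) ⟩
  (suc N ! * c ^ (suc N + L)) * c′ + suc N * (N ! * c ^ (suc N + L))
    ≡⟨ collect (suc N) (N !) (c ^ (suc N + L)) c′ ⟩
  suc N ! * c ^ suc (suc N + L)
    ≡⟨ cong (λ w → suc N ! * c ^ w) (+-suc (suc N) L) ⟨
  suc N ! * c ^ (suc N + suc L) ∎
  where
  open ≤-Reasoning
  c = suc c′
  a = negBinSum c L (suc N)
  b = negBinSum c (suc L) N
  distribute : ∀ a n b c′ p → (a + n * b) * (c′ * p) ≡ (a * p) * c′ + n * (b * (c′ * p))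
  distribute = solve-∀
  collect : ∀ n f p c′ → (n * f * p) * c′ + n * (f * p) ≡ n * f * (suc c′ * p)
  collect = solve-∀

expSum-≤-negBinSum : ∀ c m N → expSum m N * c ^ N ≤ negBinSum c (c * m) N
expSum-≤-negBinSum c m zero    = ≤-refl
expSum-≤-negBinSum c m (suc N) = begin
  (suc N * expSum m N + m ^ suc N) * (c * c ^ N)
    ≡⟨ distribute (suc N) (expSum m N) (m ^ suc N) c (c ^ N) ⟩
  suc N * c * (expSum m N * c ^ N) + (c * c ^ N) * m ^ suc N
    ≡⟨ cong (suc N * c * (expSum m N * c ^ N) +_) (^-distribʳ-* c m (suc N)) ⟨
  suc N * c * (expSum m N * c ^ N) + (c * m) ^ suc N
    ≤⟨ +-mono-≤ (*-monoʳ-≤ (suc N * c) (expSum-≤-negBinSum c m N)) (^≤rising (c * m) (suc N)) ⟩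
  suc N * c * negBinSum c (c * m) N + rising (c * m) (suc N) ∎
  where
  open ≤-Reasoning
  distribute : ∀ n E M c p → (n * E + M) * (c * p) ≡ n * c * (E * p) + (c * p) * M
  distribute = solve-∀

-- Partial sums of e^m are at most (c / c′)^((c′ + 1) m), where c = c′ + 1.
expSum-bound : ∀ c′ m N → expSum m N * c′ ^ (suc c′ * m) ≤ N ! * suc c′ ^ (suc c′ * m)
expSum-bound c′ m N = *-cancelʳ-≤ _ _ (c ^ N) {{m^n≢0 c N}} (begin
  expSum m N * c′ ^ L * c ^ N   ≡⟨ swap (expSum m N) (c′ ^ L) (c ^ N) ⟩
  expSum m N * c ^ N * c′ ^ L   ≤⟨ *-monoˡ-≤ (c′ ^ L) (expSum-≤-negBinSum c m N) ⟩
  negBinSum c L N * c′ ^ L      ≤⟨ negBinSum-bound c′ L N ⟩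
  N ! * c ^ (N + L)             ≡⟨ cong (N ! *_) (^-distribˡ-+-* c N L) ⟩
  N ! * (c ^ N * c ^ L)         ≡⟨ reassoc (N !) (c ^ N) (c ^ L) ⟩
  N ! * c ^ L * c ^ N           ∎)
  where
  open ≤-Reasoning
  c = suc c′
  L = c * m
  swap : ∀ a b d → a * b * d ≡ a * d * b
  swap = solve-∀
  reassoc : ∀ a b d → a * (b * d) ≡ a * d * b
  reassoc = solve-∀

-- In real terms m > c ln k gives k^c < e^m ≤ (c / (c - 1))^(c m); then take d-th roots.
lnBound⇒powerBound : ∀ {m c′ k} a d .{{_ : NonZero c′}} → a * d ≡ suc c′ →
  LnBound m (suc c′) k → k ^ a * c′ ^ (a * m) < suc c′ ^ (a * m)
lnBound⇒powerBound {m} {c′} {k} a d ad≡c (N , kᶜN!<expSum) =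
  ^-cancelˡ-< d (begin-strict
    (k ^ a * c′ ^ (a * m)) ^ d      ≡⟨ ^-distribʳ-* (k ^ a) (c′ ^ (a * m)) d ⟩
    (k ^ a) ^ d * (c′ ^ (a * m)) ^ d ≡⟨ cong₂ _*_ (trans (^-*-assoc k a d) (cong (k ^_) ad≡c)) (pow-split c′) ⟩
    k ^ c * c′ ^ (c * m)            <⟨ *-cancelˡ-< (N !) _ _ (begin-strict
      N ! * (k ^ c * c′ ^ (c * m))    ≡⟨ reassoc (N !) (k ^ c) (c′ ^ (c * m)) ⟩
      k ^ c * N ! * c′ ^ (c * m)      <⟨ *-monoˡ-< (c′ ^ (c * m)) {{m^n≢0 c′ (c * m)}} kᶜN!<expSum ⟩
      expSum m N * c′ ^ (c * m)       ≤⟨ expSum-bound c′ m N ⟩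
      N ! * c ^ (c * m)               ∎) ⟩
    c ^ (c * m)                     ≡⟨ pow-split c ⟨
    (c ^ (a * m)) ^ d               ∎)
  where
  open ≤-Reasoning
  c = suc c′
  reassoc : ∀ a b d → a * (b * d) ≡ b * a * d
  reassoc = solve-∀
  pow-split : ∀ x → (x ^ (a * m)) ^ d ≡ x ^ (c * m)
  pow-split x = trans (^-*-assoc x (a * m) d) (cong (x ^_) (trans (exchange a m d) (cong (_* m) ad≡c)))
    where
    exchange : ∀ a m d → a * m * d ≡ a * d * m
    exchange = solve-∀

-- Second-order Bonferroni bound (1 - x)^n ≤ 1 - n x + n(n-1)/2 x², for x = p / (p + s).
pow-≤-bonferroni : ∀ p s n →
  2 * s ^ n * ((p + s) * (p + s)) + 2 * n * p * ((p + s) * (p + s) ^ n)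
    ≤ 2 * ((p + s) * ((p + s) * (p + s) ^ n)) + n * pred n * p * p * (p + s) ^ n
pow-≤-bonferroni p s zero = ≤-reflexive (base p s)
  where
  base : ∀ p s → 2 * 1 * ((p + s) * (p + s)) + 2 * 0 * p * ((p + s) * 1) ≡ 2 * ((p + s) * ((p + s) * 1)) + 0 * p * p * 1
  base = solve-∀
pow-≤-bonferroni p s (suc n) = +-cancelʳ-≤ extra _ _ (begin
  2 * (s * S) * (q * q) + 2 * suc n * p * (q * (q * Q)) + extra
    ≡⟨ factor p s n S Q ⟩
  s * (2 * S * (q * q) + 2 * n * p * (q * Q)) + 2 * suc n * p * (q * (q * Q))
    ≤⟨ +-monoˡ-≤ _ (*-monoʳ-≤ s (pow-≤-bonferroni p s n)) ⟩
  s * (2 * (q * (q * Q)) + n * pred n * p * p * Q) + 2 * suc n * p * (q * (q * Q))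
    ≤⟨ m≤m+n _ (n * pred n * p * p * p * Q) ⟩
  s * (2 * (q * (q * Q)) + n * pred n * p * p * Q) + 2 * suc n * p * (q * (q * Q)) + n * pred n * p * p * p * Q
    ≡⟨ expand p s n (n * pred n) Q ⟩
  2 * (q * (q * (q * Q))) + (n * pred n + 2 * n) * p * p * (q * Q) + extra
    ≡⟨ cong (λ w → 2 * (q * (q * (q * Q))) + w * p * p * (q * Q) + extra) (pred-step n) ⟨
  2 * (q * (q * (q * Q))) + suc n * n * p * p * (q * Q) + extra ∎)
  where
  open ≤-Reasoning
  q = p + s
  S = s ^ n
  Q = q ^ n
  extra = 2 * n * p * s * (q * Q)
  pred-step : ∀ n → suc n * n ≡ n * pred n + 2 * n
  pred-step zero    = refl
  pred-step (suc n) = step n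
    where
    step : ∀ n → suc (suc n) * suc n ≡ suc n * n + 2 * suc n
    step = solve-∀
  factor : ∀ p s n S Q →
    2 * (s * S) * ((p + s) * (p + s)) + 2 * suc n * p * ((p + s) * ((p + s) * Q)) + 2 * n * p * s * ((p + s) * Q)
      ≡ s * (2 * S * ((p + s) * (p + s)) + 2 * n * p * ((p + s) * Q)) + 2 * suc n * p * ((p + s) * ((p + s) * Q))
  factor = solve-∀
  expand : ∀ p s n D Q →
    s * (2 * ((p + s) * ((p + s) * Q)) + D * p * p * Q) + 2 * suc n * p * ((p + s) * ((p + s) * Q)) + D * p * p * p * Q
      ≡ 2 * ((p + s) * ((p + s) * ((p + s) * Q))) + (D + 2 * n) * p * p * ((p + s) * Q) + 2 * n * p * s * ((p + s) * Q)
  expand = solve-∀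

-- For maximum degree r = r′ + 1: R = r², B = R + 1 and t = R - 1.  An edge survives the
-- rounding with probability 1/R; its final weight is R * R if it survives and R * B otherwise,
-- so its expected weight is R * B - 1 = mean.  c is the constant of the theorem.
module Weights (r′ : ℕ) where
  r = suc r′
  t = r′ * (r + 1)
  R = suc t
  B = suc R
  mean = R * R + t
  threshold = R ^ suc B * B ^ R
  c = 2 * (r ^ 3 + r) ^ 2

  finalWeight : ℕ → ℕ → ℕ
  finalWeight T F = (R * R) ^ T * (R * B) ^ F

  r*r≡R : r * r ≡ R
  r*r≡R = identity r′
    where
    identity : ∀ r′ → suc r′ * suc r′ ≡ suc (r′ * (suc r′ + 1))
    identity = solve-∀

  R*B≡1+mean : R * B ≡ suc mean
  R*B≡1+mean = identity t
    where
    identity : ∀ t → suc t * suc (suc t) ≡ suc (suc t * suc t + t)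
    identity = solve-∀

  -- The product of the identities survivor and rejected over T surviving and F rejected edges.
  finalWeight-identity : ∀ T F → finalWeight T F ^ B * (B ^ (R * T) * R ^ F) ≡ threshold ^ (T + F) * (R ^ (R * T) * B ^ F)
  finalWeight-identity T F = begin
    ((R * R) ^ T * (R * B) ^ F) ^ B * (B ^ (R * T) * R ^ F)
      ≡⟨ cong₂ _*_ (^-distribʳ-* ((R * R) ^ T) ((R * B) ^ F) B) (cong (_* R ^ F) (sym (^-*-assoc B R T))) ⟩
    ((R * R) ^ T) ^ B * ((R * B) ^ F) ^ B * ((B ^ R) ^ T * R ^ F)
      ≡⟨ cong₂ (λ x y → x * y * ((B ^ R) ^ T * R ^ F)) (^-comm (R * R) T B) (^-comm (R * B) F B) ⟩
    ((R * R) ^ B) ^ T * ((R * B) ^ B) ^ F * ((B ^ R) ^ T * R ^ F)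
      ≡⟨ regroup (((R * R) ^ B) ^ T) (((R * B) ^ B) ^ F) ((B ^ R) ^ T) (R ^ F) ⟩
    (((R * R) ^ B) ^ T * (B ^ R) ^ T) * (((R * B) ^ B) ^ F * R ^ F)
      ≡⟨ cong₂ _*_ (^-distribʳ-* ((R * R) ^ B) (B ^ R) T) (^-distribʳ-* ((R * B) ^ B) R F) ⟨
    ((R * R) ^ B * B ^ R) ^ T * ((R * B) ^ B * R) ^ F
      ≡⟨ cong₂ (λ x y → x ^ T * y ^ F) survivor rejected ⟩
    (threshold * R ^ R) ^ T * (threshold * B) ^ F
      ≡⟨ cong₂ _*_ (^-distribʳ-* threshold (R ^ R) T) (^-distribʳ-* threshold B F) ⟩
    threshold ^ T * (R ^ R) ^ T * (threshold ^ F * B ^ F)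
      ≡⟨ regroup′ (threshold ^ T) ((R ^ R) ^ T) (threshold ^ F) (B ^ F) ⟩
    threshold ^ T * threshold ^ F * ((R ^ R) ^ T * B ^ F)
      ≡⟨ cong₂ (λ x y → x * (y * B ^ F)) (sym (^-distribˡ-+-* threshold T F)) (^-*-assoc R R T) ⟩
    threshold ^ (T + F) * (R ^ (R * T) * B ^ F) ∎
    where
    open ≡-Reasoning
    regroup : ∀ a b x y → a * b * (x * y) ≡ (a * x) * (b * y)
    regroup = solve-∀
    regroup′ : ∀ a x b y → a * x * (b * y) ≡ a * b * (x * y)
    regroup′ = solve-∀
    survivor : (R * R) ^ B * B ^ R ≡ threshold * R ^ R
    survivor = trans (cong (_* B ^ R) (^-distribʳ-* R R B)) (identity R (R ^ R) (B ^ R))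
      where
      identity : ∀ R x y → R * x * (R * x) * y ≡ R * (R * x) * y * x
      identity = solve-∀
    rejected : (R * B) ^ B * R ≡ threshold * B
    rejected = trans (cong (_* R) (^-distribʳ-* R B B)) (identity R B (R ^ R) (B ^ R))
      where
      identity : ∀ R B x y → R * x * (B * y) * R ≡ R * (R * x) * y * B
      identity = solve-∀

  threshold≤finalWeight : ∀ {T F} → R * T ≤ F → threshold ^ (T + F) ≤ finalWeight T F ^ B
  threshold≤finalWeight {T} {F} RT≤F = *-cancelʳ-≤ _ _ X {{X≢0}} (begin
    threshold ^ (T + F) * X   ≡⟨ finalWeight-identity T F ⟨
    finalWeight T F ^ B * Y        ≤⟨ *-monoʳ-≤ (finalWeight T F ^ B) (^-exchange-≤ (n≤1+n R) RT≤F) ⟩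
    finalWeight T F ^ B * X        ∎)
    where
    open ≤-Reasoning
    X = R ^ (R * T) * B ^ F
    Y = B ^ (R * T) * R ^ F
    X≢0 : NonZero X
    X≢0 = m*n≢0 (R ^ (R * T)) (B ^ F) {{m^n≢0 R (R * T)}} {{m^n≢0 B F}}

  -- c - 1 = q = p + s is split so that mean * c = R * B * s.
  p = R + B
  s = 2 * B * mean
  q = p + s

  c≡1+q : c ≡ suc q
  c≡1+q = identity r′
    where
    identity : ∀ r′ → let t = r′ * (suc r′ + 1) ; R = suc t ; B = suc R in
      2 * ((suc r′ * (suc r′ * (suc r′ * 1)) + suc r′) * ((suc r′ * (suc r′ * (suc r′ * 1)) + suc r′) * 1))
        ≡ suc (R + B + 2 * B * (R * R + t))
    identity = solve-∀

  B*2RB≡1+q : B * (2 * R * B) ≡ suc q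
  B*2RB≡1+q = identity t
    where
    identity : ∀ t → let R = suc t ; B = suc R in B * (2 * R * B) ≡ suc (R + B + 2 * B * (R * R + t))
    identity = solve-∀

  -- (s / q)^B ≤ R / B, from the second-order Bonferroni bound with x = p / q.
  B*s^B≤R*q^B : B * s ^ B ≤ R * q ^ B
  B*s^B≤R*q^B = *-cancelʳ-≤ _ _ (2 * (q * q)) {{2q²≢0}} (+-cancelʳ-≤ (2 * (q * (q * Q))) _ _
    (≤-trans (m≤m+n _ (slack * Q)) (+-cancelʳ-≤ (B * (B * R * p * p * Q)) _ _ (begin
      B * S * (2 * (q * q)) + 2 * (q * (q * Q)) + slack * Q + B * (B * R * p * p * Q)
        ≡⟨ collect t S Q ⟩
      B * (2 * S * (q * q) + 2 * B * p * (q * Q))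
        ≤⟨ *-monoʳ-≤ B (pow-≤-bonferroni p s B) ⟩
      B * (2 * (q * (q * Q)) + B * R * p * p * Q)
        ≡⟨ split t Q ⟩
      R * Q * (2 * (q * q)) + 2 * (q * (q * Q)) + B * (B * R * p * p * Q) ∎))))
    where
    open ≤-Reasoning
    S = s ^ B
    Q = q ^ B
    -- slack = 2 B² p q - 2 q² - B² R p², a polynomial in t with nonnegative coefficients.
    slack = 34 + 96 * t + 85 * t * t + 31 * t * t * t + 4 * t * t * t * t
    2q²≢0 : NonZero (2 * (q * q))
    2q²≢0 = m*n≢0 2 (q * q) {{_}} {{m*n≢0 q q}}
    collect : ∀ t S Q → let R = suc t ; B = suc R ; p = R + B ; q = p + 2 * B * (R * R + t) in
      B * S * (2 * (q * q)) + 2 * (q * (q * Q)) + (34 + 96 * t + 85 * t * t + 31 * t * t * t + 4 * t * t * t * t) * Q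
        + B * (B * R * p * p * Q)
      ≡ B * (2 * S * (q * q) + 2 * B * p * (q * Q))
    collect = solve-∀
    split : ∀ t Q → let R = suc t ; B = suc R ; p = R + B ; q = p + 2 * B * (R * R + t) in
      B * (2 * (q * (q * Q)) + B * R * p * p * Q) ≡ R * Q * (2 * (q * q)) + 2 * (q * (q * Q)) + B * (B * R * p * p * Q)
    split = solve-∀

  [mean*[1+q]]^B≤q^B*threshold : (mean * suc q) ^ B ≤ q ^ B * threshold
  [mean*[1+q]]^B≤q^B*threshold = *-cancelˡ-≤ B (begin
    B * (mean * suc q) ^ B          ≡⟨ cong (λ x → B * x ^ B) (factor t) ⟩
    B * (R * B * s) ^ B             ≡⟨ cong (B *_) (trans (^-distribʳ-* (R * B) s B) (cong (_* s ^ B) (^-distribʳ-* R B B))) ⟩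
    B * (R ^ B * B ^ B * s ^ B)     ≡⟨ regroup B (R ^ B) (B ^ B) (s ^ B) ⟩
    R ^ B * B ^ B * (B * s ^ B)     ≤⟨ *-monoʳ-≤ (R ^ B * B ^ B) B*s^B≤R*q^B ⟩
    R ^ B * B ^ B * (R * q ^ B)     ≡⟨ collect B R (R ^ R) (B ^ R) (q ^ B) ⟩
    B * (q ^ B * threshold)         ∎)
    where
    open ≤-Reasoning
    factor : ∀ t → let R = suc t ; B = suc R in
      (R * R + t) * suc (R + B + 2 * B * (R * R + t)) ≡ R * B * (2 * B * (R * R + t))
    factor = solve-∀
    regroup : ∀ B x y z → B * (x * y * z) ≡ x * y * (B * z)
    regroup = solve-∀
    collect : ∀ B R x y z → R * x * (B * y) * (R * z) ≡ B * (z * (R * (R * x) * y))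
    collect = solve-∀

  -- Per edge threshold^(1/B) / mean ≥ c / (c - 1), and (c / (c - 1))^m > k when m > c ln k.
  lnBound⇒[k*mean^m]^B<threshold^m : ∀ {m k} → LnBound m c k → (k * mean ^ m) ^ B < threshold ^ m
  lnBound⇒[k*mean^m]^B<threshold^m {m} {k} m>clnk = *-cancelʳ-< (suc q ^ (B * m)) _ _ (begin-strict
    (k * mean ^ m) ^ B * suc q ^ (B * m)
      ≡⟨ cong₂ _*_ (^-distribʳ-* k (mean ^ m) B) (sym (^-*-assoc (suc q) B m)) ⟩
    k ^ B * (mean ^ m) ^ B * (suc q ^ B) ^ m
      ≡⟨ cong (λ x → k ^ B * x * (suc q ^ B) ^ m) (^-comm mean m B) ⟩
    k ^ B * (mean ^ B) ^ m * (suc q ^ B) ^ m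
      ≡⟨ trans (*-assoc (k ^ B) _ _) (cong (k ^ B *_) (sym (^-distribʳ-* (mean ^ B) (suc q ^ B) m))) ⟩
    k ^ B * (mean ^ B * suc q ^ B) ^ m
      ≡⟨ cong (λ x → k ^ B * x ^ m) (^-distribʳ-* mean (suc q) B) ⟨
    k ^ B * ((mean * suc q) ^ B) ^ m
      ≤⟨ *-monoʳ-≤ (k ^ B) (^-monoˡ-≤ m [mean*[1+q]]^B≤q^B*threshold) ⟩
    k ^ B * (q ^ B * threshold) ^ m
      ≡⟨ cong (k ^ B *_) (^-distribʳ-* (q ^ B) threshold m) ⟩
    k ^ B * ((q ^ B) ^ m * threshold ^ m)
      ≡⟨ trans (sym (*-assoc (k ^ B) _ _)) (cong (λ x → k ^ B * x * threshold ^ m) (^-*-assoc q B m)) ⟩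
    k ^ B * q ^ (B * m) * threshold ^ m
      <⟨ *-monoˡ-< (threshold ^ m) {{m^n≢0 threshold m {{threshold≢0}}}}
           (lnBound⇒powerBound {m} {q} {k} B (2 * R * B) B*2RB≡1+q (subst (λ x → LnBound m x k) c≡1+q m>clnk)) ⟩
    suc q ^ (B * m) * threshold ^ m
      ≡⟨ *-comm (suc q ^ (B * m)) (threshold ^ m) ⟩
    threshold ^ m * suc q ^ (B * m) ∎)
    where
    open ≤-Reasoning
    threshold≢0 : NonZero threshold
    threshold≢0 = m*n≢0 (R ^ suc B) (B ^ R) {{m^n≢0 R (suc B)}} {{m^n≢0 B R}}

≡ᵇ-refl : ∀ n → (n ≡ᵇ n) ≡ true
≡ᵇ-refl zero    = refl
≡ᵇ-refl (suc n) = ≡ᵇ-refl n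

≢⇒≡ᵇ≡false : ∀ {m n} → m ≢ n → (m ≡ᵇ n) ≡ false
≢⇒≡ᵇ≡false {zero}  {zero}  m≢n = contradiction refl m≢n
≢⇒≡ᵇ≡false {zero}  {suc n} _   = refl
≢⇒≡ᵇ≡false {suc m} {zero}  _   = refl
≢⇒≡ᵇ≡false {suc m} {suc n} m≢n = ≢⇒≡ᵇ≡false (m≢n ∘ cong suc)

<⇒<ᵇ≡true : ∀ {m n} → m < n → (m <ᵇ n) ≡ true
<⇒<ᵇ≡true {zero}  {suc n} _         = refl
<⇒<ᵇ≡true {suc m} {suc n} (s≤s m<n) = <⇒<ᵇ≡true m<n

<ᵇ-irrefl : ∀ n → (n <ᵇ n) ≡ false
<ᵇ-irrefl zero    = refl
<ᵇ-irrefl (suc n) = <ᵇ-irrefl n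

<ᵇ-suc : ∀ {m n} → m ≢ n → (m <ᵇ suc n) ≡ (m <ᵇ n)
<ᵇ-suc {zero}  {zero}  m≢n = contradiction refl m≢n
<ᵇ-suc {zero}  {suc n} _   = refl
<ᵇ-suc {suc m} {zero}  _   = refl
<ᵇ-suc {suc m} {suc n} m≢n = <ᵇ-suc (m≢n ∘ cong suc)

sum-const : ∀ n a → ∑[ i < n ] a ≡ n * a
sum-const zero    a = refl
sum-const (suc n) a = cong (a +_) (sum-const n a)

sum-indicator : ∀ {n ℓ} a → ℓ < n → ∑[ v < n ] (if toℕ v ≡ᵇ ℓ then a else 0) ≡ a
sum-indicator {suc n} {zero}  a _         = trans (cong (a +_) (sum-const n 0)) (trans (cong (a +_) (*-zeroʳ n)) (+-identityʳ a))
sum-indicator {suc n} {suc ℓ} a (s≤s ℓ<n) = sum-indicator a ℓ<n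

term-≤-sum : ∀ {n} (t : Vector ℕ n) i → t i ≤ sum t
term-≤-sum {suc n} t i = ≤-trans (m≤m+n (t i) _) (≤-reflexive (sym (sum-remove {i = i} t)))

∃-≤-average : ∀ {n} .{{_ : NonZero n}} (g : Vector ℕ n) a → sum g ≤ n * a → ∃[ v ] g v ≤ a
∃-≤-average {suc n} g a ∑g≤ with g Fin.zero ≤? a
... | yes g₀≤a = Fin.zero , g₀≤a
... | no  g₀≰a with n
...   | zero   = contradiction (≤-trans (m≤m+n (g Fin.zero) 0) (≤-trans ∑g≤ (≤-reflexive (+-identityʳ a)))) g₀≰a
...   | suc n′ with ∃-≤-average (g ∘ Fin.suc) a (+-cancelˡ-≤ a _ _ (≤-trans (+-monoˡ-≤ _ (<⇒≤ (≰⇒> g₀≰a))) ∑g≤))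
...     | v , gv≤a = Fin.suc v , gv≤a

Assignment : Set
Assignment = ℕ → ℕ

_[_]≔_ : Assignment → ℕ → ℕ → Assignment
(σ [ τ ]≔ v) x = if x ≡ᵇ τ then v else σ x

-- A pessimistic estimator: F τ σ is meant to depend only on the coordinates of σ below τ.
Estimator : Set
Estimator = ℕ → Assignment → ℕ

_⊗_ : Estimator → Estimator → Estimator
(F ⊗ G) τ σ = F τ σ * G τ σ

-- The method of conditional expectations for r equally likely values at each coordinate.
module ConditionalExpectation (r : ℕ) where

  AveragesAt : ℕ → Estimator → Set
  AveragesAt τ F = ∀ σ → ∑[ v < r ] F (suc τ) (σ [ τ ]≔ toℕ v) ≡ r * F τ σ

  Averaging : Estimator → Set
  Averaging F = ∀ τ → AveragesAt τ F

  UnaffectedAt : ℕ → Estimator → Set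
  UnaffectedAt τ F = ∀ σ v → F (suc τ) (σ [ τ ]≔ v) ≡ F τ σ

  unaffected⇒averages : ∀ {τ F} → UnaffectedAt τ F → AveragesAt τ F
  unaffected⇒averages {τ} {F} same σ =
    trans (sum-cong-≗ {r} (λ v → same σ (toℕ v))) (sum-const r (F τ σ))

  unaffected-⊗ : ∀ {τ F G} → UnaffectedAt τ F → UnaffectedAt τ G → UnaffectedAt τ (F ⊗ G)
  unaffected-⊗ sameF sameG σ v = cong₂ _*_ (sameF σ v) (sameG σ v)

  averages-⊗ʳ : ∀ {τ F G} → AveragesAt τ F → UnaffectedAt τ G → AveragesAt τ (F ⊗ G)
  averages-⊗ʳ {τ} {F} {G} avg same σ = begin
    ∑[ v < r ] (F (suc τ) (σ [ τ ]≔ toℕ v) * G (suc τ) (σ [ τ ]≔ toℕ v))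
      ≡⟨ sum-cong-≗ {r} (λ v → cong (F (suc τ) (σ [ τ ]≔ toℕ v) *_) (same σ (toℕ v))) ⟩
    ∑[ v < r ] (F (suc τ) (σ [ τ ]≔ toℕ v) * G τ σ)
      ≡⟨ *-distribʳ-sum {r} (G τ σ) (λ v → F (suc τ) (σ [ τ ]≔ toℕ v)) ⟨
    ∑[ v < r ] F (suc τ) (σ [ τ ]≔ toℕ v) * G τ σ
      ≡⟨ cong (_* G τ σ) (avg σ) ⟩
    r * F τ σ * G τ σ
      ≡⟨ *-assoc r (F τ σ) (G τ σ) ⟩
    r * (F τ σ * G τ σ) ∎
    where open ≡-Reasoning

  averages-⊗ˡ : ∀ {τ F G} → UnaffectedAt τ F → AveragesAt τ G → AveragesAt τ (F ⊗ G)
  averages-⊗ˡ {τ} {F} {G} same avg σ = begin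
    ∑[ v < r ] (F (suc τ) (σ [ τ ]≔ toℕ v) * G (suc τ) (σ [ τ ]≔ toℕ v))
      ≡⟨ sum-cong-≗ {r} (λ v → cong (_* G (suc τ) (σ [ τ ]≔ toℕ v)) (same σ (toℕ v))) ⟩
    ∑[ v < r ] (F τ σ * G (suc τ) (σ [ τ ]≔ toℕ v))
      ≡⟨ *-distribˡ-sum {r} (F τ σ) (λ v → G (suc τ) (σ [ τ ]≔ toℕ v)) ⟨
    F τ σ * ∑[ v < r ] G (suc τ) (σ [ τ ]≔ toℕ v)
      ≡⟨ cong (F τ σ *_) (avg σ) ⟩
    F τ σ * (r * G τ σ)
      ≡⟨ x∙yz≈y∙xz (F τ σ) r (G τ σ) ⟩
    r * (F τ σ * G τ σ) ∎
    where open ≡-Reasoning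

  averages-∑ : ∀ {τ k} (F : Fin k → Estimator) → (∀ i → AveragesAt τ (F i)) →
    AveragesAt τ (λ τ σ → ∑[ i < k ] F i τ σ)
  averages-∑ {τ} {k} F avg σ = begin
    ∑[ v < r ] ∑[ i < k ] F i (suc τ) (σ [ τ ]≔ toℕ v) ≡⟨ ∑-comm {r} {k} (λ v i → F i (suc τ) (σ [ τ ]≔ toℕ v)) ⟩
    ∑[ i < k ] ∑[ v < r ] F i (suc τ) (σ [ τ ]≔ toℕ v) ≡⟨ sum-cong-≗ {k} (λ i → avg i σ) ⟩
    ∑[ i < k ] (r * F i τ σ)                             ≡⟨ *-distribˡ-sum {k} r (λ i → F i τ σ) ⟨
    r * ∑[ i < k ] F i τ σ                               ∎
    where open ≡-Reasoning

  averages-complement : ∀ {τ F G} a → (∀ τ σ → F τ σ + G τ σ ≡ a) → AveragesAt τ G → AveragesAt τ F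
  averages-complement {τ} {F} {G} a F+G≡a avg σ = +-cancelʳ-≡ (∑[ v < r ] G′ v) _ _ (begin
    ∑[ v < r ] F′ v + ∑[ v < r ] G′ v   ≡⟨ ∑-distrib-+ {r} F′ G′ ⟨
    ∑[ v < r ] (F′ v + G′ v)            ≡⟨ sum-cong-≗ {r} (λ v → F+G≡a (suc τ) (σ [ τ ]≔ toℕ v)) ⟩
    ∑[ v < r ] a                        ≡⟨ sum-const r a ⟩
    r * a                               ≡⟨ cong (r *_) (F+G≡a τ σ) ⟨
    r * (F τ σ + G τ σ)                 ≡⟨ *-distribˡ-+ r (F τ σ) (G τ σ) ⟩
    r * F τ σ + r * G τ σ               ≡⟨ cong (r * F τ σ +_) (avg σ) ⟨
    r * F τ σ + ∑[ v < r ] G′ v         ∎)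
    where
    open ≡-Reasoning
    F′ G′ : Fin r → ℕ
    F′ v = F (suc τ) (σ [ τ ]≔ toℕ v)
    G′ v = G (suc τ) (σ [ τ ]≔ toℕ v)

  derandomise : ∀ {F} .{{_ : NonZero r}} → Averaging F → ∀ τ σ₀ → ∃[ σ ] F τ σ ≤ F 0 σ₀
  derandomise avg zero    σ₀ = σ₀ , ≤-refl
  derandomise {F} avg (suc τ) σ₀ with derandomise avg τ σ₀
  ... | σ , Fσ≤ with ∃-≤-average (λ v → F (suc τ) (σ [ τ ]≔ toℕ v)) (F τ σ) (≤-reflexive (avg τ σ))
  ...   | v , Fv≤ = σ [ τ ]≔ toℕ v , ≤-trans Fv≤ Fσ≤

  -- r · Pr[σ x = ℓ | σ fixed below τ], for σ x uniform among r values.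
  agreement : ℕ → ℕ → Estimator
  agreement x ℓ τ σ = if x <ᵇ τ then (if σ x ≡ᵇ ℓ then r else 0) else 1

  agreement-unaffected : ∀ {x ℓ τ} → x ≢ τ → UnaffectedAt τ (agreement x ℓ)
  agreement-unaffected x≢τ σ v rewrite <ᵇ-suc x≢τ | ≢⇒≡ᵇ≡false x≢τ = refl

  agreement-averages : ∀ {x ℓ} → ℓ < r → AveragesAt x (agreement x ℓ)
  agreement-averages {x} ℓ<r σ rewrite <⇒<ᵇ≡true (n<1+n x) | ≡ᵇ-refl x | <ᵇ-irrefl x =
    trans (sum-indicator r ℓ<r) (sym (*-identityʳ r))

  agreement-≤ : ∀ {x ℓ τ σ} .{{_ : NonZero r}} → agreement x ℓ τ σ ≤ r
  agreement-≤ {x} {ℓ} {τ} {σ} with x <ᵇ τ | σ x ≡ᵇ ℓ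
  ... | true  | true  = ≤-refl
  ... | true  | false = z≤n
  ... | false | _     = >-nonZero⁻¹ r

  agreement-fixed : ∀ {x ℓ τ σ} → x < τ → agreement x ℓ τ σ ≡ (if σ x ≡ᵇ ℓ then r else 0)
  agreement-fixed x<τ rewrite <⇒<ᵇ≡true x<τ = refl

  agreement-⊗-averaging : ∀ {x ℓ y ℓ′} → x ≢ y → ℓ < r → ℓ′ < r → Averaging (agreement x ℓ ⊗ agreement y ℓ′)
  agreement-⊗-averaging {x} {ℓ} {y} {ℓ′} x≢y ℓ<r ℓ′<r τ with x ≟ τ | y ≟ τ
  ... | yes refl | _        =
    averages-⊗ʳ {F = agreement x ℓ} {G = agreement y ℓ′} (agreement-averages {x} ℓ<r) (agreement-unaffected (x≢y ∘ sym))
  ... | no x≢τ   | yes refl =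
    averages-⊗ˡ {F = agreement x ℓ} {G = agreement y ℓ′} (agreement-unaffected x≢τ) (agreement-averages {y} ℓ′<r)
  ... | no x≢τ   | no y≢τ   = unaffected⇒averages {F = agreement x ℓ ⊗ agreement y ℓ′}
    (unaffected-⊗ {F = agreement x ℓ} {G = agreement y ℓ′} (agreement-unaffected x≢τ) (agreement-unaffected y≢τ))

product-map-const : ∀ {A : Set} (g : A → ℕ) {a} → (∀ x → g x ≡ a) → ∀ xs → product (map g xs) ≡ a ^ length xs
product-map-const g ga []       = refl
product-map-const g ga (x ∷ xs) = cong₂ _*_ (ga x) (product-map-const g ga xs)

product-map-if : ∀ {A : Set} {P : A → Set} (P? : Decidable P) a b xs →
  product (map (λ x → if does (P? x) then a else b) xs) ≡ a ^ length (filter P? xs) * b ^ length (filter (∁? P?) xs)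
product-map-if P? a b []       = refl
product-map-if P? a b (x ∷ xs) with does (P? x)
... | true  = trans (cong (a *_) (product-map-if P? a b xs)) (sym (*-assoc a _ _))
... | false = trans (cong (b *_) (product-map-if P? a b xs)) (x∙yz≈y∙xz b (a ^ length (filter P? xs)) (b ^ length (filter (∁? P?) xs)))

length-filter-∁ : ∀ {A : Set} {P : A → Set} (P? : Decidable P) xs →
  length (filter P? xs) + length (filter (∁? P?) xs) ≡ length xs
length-filter-∁ P? []       = refl
length-filter-∁ P? (x ∷ xs) with does (P? x)
... | true  = cong suc (length-filter-∁ P? xs)
... | false = trans (+-suc _ _) (cong suc (length-filter-∁ P? xs))

∈⇒removal : ∀ {A : Set} {x : A} {ys} → x ∈ ys →
  ∃[ zs ] (length ys ≡ suc (length zs) × (∀ {y} → y ∈ ys → y ≢ x → y ∈ zs))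
∈⇒removal {ys = _ ∷ zs} (here refl) = zs , refl , λ { (here y≡x) y≢x → contradiction y≡x y≢x ; (there y∈) _ → y∈ }
∈⇒removal {ys = z ∷ _}  (there x∈) with ∈⇒removal x∈
... | zs , len≡ , keep = z ∷ zs , cong suc len≡ , λ { (here y≡z) _ → here y≡z ; (there y∈) y≢x → there (keep y∈ y≢x) }

Unique⇒length-≤ : ∀ {A : Set} {xs ys : List A} → Unique xs → (∀ {x} → x ∈ xs → x ∈ ys) → length xs ≤ length ys
Unique⇒length-≤ {xs = []}     _             _     = z≤n
Unique⇒length-≤ {xs = x ∷ xs} (x∉xs ∷ !xs) xs⊆ys with ∈⇒removal (xs⊆ys (here refl))
... | zs , len≡ , keep = subst (suc (length xs) ≤_) (sym len≡)
  (s≤s (Unique⇒length-≤ !xs (λ y∈xs → keep (xs⊆ys (there y∈xs)) (λ y≡x → All.lookup x∉xs y∈xs (sym y≡x)))))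

AllPairs-strengthen : ∀ {A : Set} {P : A → Set} {R S : A → A → Set} {xs} →
  (∀ {x y} → P x → P y → R x y → S x y) → All P xs → AllPairs R xs → AllPairs S xs
AllPairs-strengthen strengthen []         []           = []
AllPairs-strengthen strengthen (px ∷ pxs) (rx ∷ rxs) =
  All.zipWith (λ (py , r) → strengthen px py r) (pxs , rx) ∷ AllPairs-strengthen strengthen pxs rxs

maxDegree-zero : ∀ {n} {E : List (Edge n)} → MaxDegreeAtMost E 0 → ∀ {L} → All (_∈ E) L → length L ≡ 0
maxDegree-zero deg []                       = refl
maxDegree-zero deg {(u , v) ∷ _} (f∈E ∷ _) with deg u ((u , v) ∷ []) ([] ∷ []) ((f∈E , inj₁ refl) ∷ [])
... | ()

∈-⋃ : ∀ {n k} (M : Vector (List (Edge n)) k) i {f} → f ∈ M i → f ∈ ⋃ M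
∈-⋃ M i f∈ = ∈-concat⁺′ f∈ (∈-tabulate⁺ i)

∈-⋃⁻ : ∀ {n k} (M : Vector (List (Edge n)) k) {f} → f ∈ ⋃ M → ∃[ i ] f ∈ M i
∈-⋃⁻ M f∈ = tabulate⁻ (∈-concat⁻ (toList M) f∈)

-- Coordinate toℕ x of an assignment is the number picked by vertex x.
module Rounding {n k} (M : Vector (List (Edge n)) k) (r′ : ℕ)
  (M-matching : ∀ i → IsMatching (M i)) (maxDegree : MaxDegreeAtMost (⋃ M) (suc r′)) where

  open Weights r′
  open ConditionalExpectation r
  open import Data.List.Membership.DecPropositional (_≟ₑ_ {n}) using (_∈?_)

  G : List (Edge n)
  G = deduplicate _≟ₑ_ (⋃ M)

  incident? : (x : Fin n) → Decidable (Incident x)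
  incident? x (u , v) = (x ≟ᶠ u) ⊎-dec (x ≟ᶠ v)

  edgesAt : Fin n → List (Edge n)
  edgesAt x = filter (incident? x) G

  ∈-edgesAt : ∀ {x f} → f ∈ ⋃ M → Incident x f → f ∈ edgesAt x
  ∈-edgesAt {x} f∈ x∈f = ∈-filter⁺ (incident? x) (∈-deduplicate⁺ _≟ₑ_ f∈) x∈f

  label : Fin n → Edge n → ℕ
  label x f with f ∈? edgesAt x
  ... | yes f∈ = toℕ (index f∈)
  ... | no _   = 0

  label-< : ∀ {x f} → f ∈ ⋃ M → Incident x f → label x f < r
  label-< {x} {f} f∈ x∈f with f ∈? edgesAt x
  ... | no f∉  = contradiction (∈-edgesAt f∈ x∈f) f∉
  ... | yes f∈ₓ = <-≤-trans (toℕ<n (index f∈ₓ))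
    (maxDegree x (edgesAt x) (Unique.filter⁺ (incident? x) (deduplicate-! _≟ₑ_ (⋃ M)))
      (All.tabulate (λ g∈ → let g∈G , x∈g = ∈-filter⁻ (incident? x) {xs = G} g∈ in ∈-deduplicate⁻ _≟ₑ_ (⋃ M) g∈G , x∈g)))

  label-injective : ∀ {x f g} → f ∈ ⋃ M → g ∈ ⋃ M → Incident x f → Incident x g → label x f ≡ label x g → f ≡ g
  label-injective {x} {f} {g} f∈ g∈ x∈f x∈g same with f ∈? edgesAt x | g ∈? edgesAt x
  ... | yes f∈ₓ | yes g∈ₓ = index-injective (setoid (Edge n)) f∈ₓ g∈ₓ (toℕ-injective same)
  ... | no f∉   | _       = contradiction (∈-edgesAt f∈ x∈f) f∉
  ... | yes _   | no g∉   = contradiction (∈-edgesAt g∈ x∈g) g∉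

  -- R · Pr[f survives | σ fixed below τ]
  survival : Edge n → Estimator
  survival f@(u , w) = agreement (toℕ u) (label u f) ⊗ agreement (toℕ w) (label w f)

  -- E[final weight of f | σ fixed below τ]
  expectedWeight : Edge n → Estimator
  expectedWeight f τ σ = R * B ∸ survival f τ σ

  matchingWeight : List (Edge n) → Estimator
  matchingWeight L τ σ = product (map (λ f → expectedWeight f τ σ) L)

  total : ℕ
  total = ∑[ i < k ] e (M i)

  -- The scaling makes every summand start out at mean ^ total.
  scale : Fin k → ℕ
  scale i = mean ^ (total ∸ e (M i))

  potential : Estimator
  potential τ σ = ∑[ i < k ] (scale i * matchingWeight (M i) τ σ)

  survival-≤ : ∀ f τ σ → survival f τ σ ≤ R
  survival-≤ f@(u , w) τ σ = ≤-trans
    (*-mono-≤ (agreement-≤ {toℕ u} {label u f} {τ} {σ}) (agreement-≤ {toℕ w} {label w f} {τ} {σ}))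
    (≤-reflexive r*r≡R)

  expectedWeight+survival : ∀ f τ σ → expectedWeight f τ σ + survival f τ σ ≡ R * B
  expectedWeight+survival f τ σ = m∸n+n≡m (≤-trans (survival-≤ f τ σ) (m≤m*n R B))

  expectedWeight-averaging : ∀ {f} → f ∈ ⋃ M → ValidEdge f → Averaging (expectedWeight f)
  expectedWeight-averaging {f@(u , w)} f∈ u<w τ =
    averages-complement {F = expectedWeight f} {G = survival f} (R * B) (expectedWeight+survival f)
      (agreement-⊗-averaging (<⇒≢ u<w) (label-< f∈ (inj₁ refl)) (label-< f∈ (inj₂ refl)) τ)

  Touches : ℕ → Edge n → Set
  Touches τ (u , w) = toℕ u ≡ τ ⊎ toℕ w ≡ τ

  expectedWeight-unaffected : ∀ {τ f} → ¬ Touches τ f → UnaffectedAt τ (expectedWeight f)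
  expectedWeight-unaffected {τ} {f@(u , w)} ¬touch σ v = cong (R * B ∸_)
    (unaffected-⊗ {F = agreement (toℕ u) (label u f)} {G = agreement (toℕ w) (label w f)}
      (agreement-unaffected (¬touch ∘ inj₁)) (agreement-unaffected (¬touch ∘ inj₂)) σ v)

  disjoint⇒¬touches : ∀ {τ f g} → VertexDisjoint f g → Touches τ f → ¬ Touches τ g
  disjoint⇒¬touches (u≢u′ , _ , _ , _) (inj₁ refl) (inj₁ eq) = u≢u′ (toℕ-injective (sym eq))
  disjoint⇒¬touches (_ , u≢w′ , _ , _) (inj₁ refl) (inj₂ eq) = u≢w′ (toℕ-injective (sym eq))
  disjoint⇒¬touches (_ , _ , w≢u′ , _) (inj₂ refl) (inj₁ eq) = w≢u′ (toℕ-injective (sym eq))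
  disjoint⇒¬touches (_ , _ , _ , w≢w′) (inj₂ refl) (inj₂ eq) = w≢w′ (toℕ-injective (sym eq))

  matchingWeight-unaffected : ∀ {τ L} → All (¬_ ∘ Touches τ) L → UnaffectedAt τ (matchingWeight L)
  matchingWeight-unaffected []                  σ v = refl
  matchingWeight-unaffected (¬touch ∷ ¬touches) σ v =
    cong₂ _*_ (expectedWeight-unaffected ¬touch σ v) (matchingWeight-unaffected ¬touches σ v)

  -- In a matching, at most one edge touches the vertex being fixed.
  matchingWeight-averaging : ∀ {L} → IsMatching L → All (_∈ ⋃ M) L → Averaging (matchingWeight L)
  matchingWeight-averaging {[]}    _ _ τ = unaffected⇒averages {τ} {matchingWeight []} (λ σ v → refl)
  matchingWeight-averaging {f@(u , w) ∷ L} (f-valid ∷ valid , f-disjoint ∷ disjoint) (f∈ ∷ L⊆) τ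
    with (toℕ u ≟ τ) ⊎-dec (toℕ w ≟ τ)
  ... | yes touch = averages-⊗ʳ {F = expectedWeight f} {G = matchingWeight L}
    (expectedWeight-averaging f∈ f-valid τ) (matchingWeight-unaffected (All.map (λ d → disjoint⇒¬touches d touch) f-disjoint))
  ... | no ¬touch = averages-⊗ˡ {F = expectedWeight f} {G = matchingWeight L}
    (expectedWeight-unaffected ¬touch) (matchingWeight-averaging (valid , disjoint) L⊆ τ)

  potential-averaging : Averaging potential
  potential-averaging τ = averages-∑ (λ i → (λ _ _ → scale i) ⊗ matchingWeight (M i))
    (λ i → averages-⊗ˡ {F = λ _ _ → scale i} {G = matchingWeight (M i)} (λ σ v → refl)
      (matchingWeight-averaging (M-matching i) (All.tabulate (∈-⋃ M i)) τ))

  scale-spec : ∀ i → scale i * mean ^ e (M i) ≡ mean ^ total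
  scale-spec i = trans (sym (^-distribˡ-+-* mean (total ∸ e (M i)) (e (M i))))
    (cong (mean ^_) (m∸n+n≡m (term-≤-sum (λ j → e (M j)) i)))

  potential-initial : ∀ σ → potential 0 σ ≡ k * mean ^ total
  potential-initial σ = trans (sum-cong-≗ {k} start) (sum-const k (mean ^ total))
    where
    start : ∀ i → scale i * matchingWeight (M i) 0 σ ≡ mean ^ total
    start i = trans (cong (scale i *_) (product-map-const _ (λ _ → cong (_∸ 1) R*B≡1+mean) (M i)))
      (scale-spec i)

  survives : Assignment → Edge n → Bool
  survives σ f@(u , w) = (σ (toℕ u) ≡ᵇ label u f) ∧ (σ (toℕ w) ≡ᵇ label w f)

  survives? : (σ : Assignment) → Decidable (T ∘ survives σ)
  survives? σ f = T? (survives σ f)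

  expectedWeight-final : ∀ σ f → expectedWeight f n σ ≡ (if survives σ f then R * R else R * B)
  expectedWeight-final σ f@(u , w)
    rewrite agreement-fixed {toℕ u} {label u f} {n} {σ} (toℕ<n u) | agreement-fixed {toℕ w} {label w f} {n} {σ} (toℕ<n w)
    with σ (toℕ u) ≡ᵇ label u f | σ (toℕ w) ≡ᵇ label w f
  ... | true  | true  = trans (cong (R * B ∸_) r*r≡R) (trans (cong (_∸ R) (*-suc R R)) (m+n∸m≡n R (R * R)))
  ... | true  | false = cong (R * B ∸_) (*-zeroʳ r)
  ... | false | _     = refl

  kept dropped : Assignment → List (Edge n) → ℕ
  kept    σ L = length (filter (survives? σ) L)
  dropped σ L = length (filter (∁? (survives? σ)) L)

  matchingWeight-final : ∀ σ L → matchingWeight L n σ ≡ finalWeight (kept σ L) (dropped σ L)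
  matchingWeight-final σ L = trans (cong product (map-cong (expectedWeight-final σ) L)) (product-map-if (survives? σ) (R * R) (R * B) L)

  derandomised : ∃[ σ ] potential n σ ≤ potential 0 (λ _ → 0)
  derandomised = derandomise {potential} potential-averaging n (λ _ → 0)

  σ* : Assignment
  σ* = proj₁ derandomised

  H : List (Edge n)
  H = filter (survives? σ*) G

  survivor-label : ∀ {x f} → Incident x f → T (survives σ* f) → σ* (toℕ x) ≡ label x f
  survivor-label {x} {u , w} (inj₁ refl) surv = ≡ᵇ⇒≡ _ _ (proj₁ (Equivalence.to T-∧ surv))
  survivor-label {x} {u , w} (inj₂ refl) surv = ≡ᵇ⇒≡ _ _ (proj₂ (Equivalence.to (T-∧ {σ* (toℕ u) ≡ᵇ label u (u , w)}) surv))

  Survivor : Edge n → Set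
  Survivor f = f ∈ ⋃ M × T (survives σ* f)

  H-survivors : All Survivor H
  H-survivors = All.tabulate λ f∈ →
    let f∈G , surv = ∈-filter⁻ (survives? σ*) {xs = G} f∈ in ∈-deduplicate⁻ _≟ₑ_ (⋃ M) f∈G , surv

  H⊆⋃M : All (_∈ ⋃ M) H
  H⊆⋃M = All.map proj₁ H-survivors

  survivors-disjoint : ∀ {f g} → Survivor f → Survivor g → f ≢ g → VertexDisjoint f g
  survivors-disjoint {u , w} {u′ , w′} (f∈ , f-surv) (g∈ , g-surv) f≢g =
    (λ u≡u′ → f≢g (shared (inj₁ refl) (inj₁ u≡u′))) ,
    (λ u≡w′ → f≢g (shared (inj₁ refl) (inj₂ u≡w′))) ,
    (λ w≡u′ → f≢g (shared (inj₂ refl) (inj₁ w≡u′))) ,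
    (λ w≡w′ → f≢g (shared (inj₂ refl) (inj₂ w≡w′)))
    where
    shared : ∀ {x} → Incident x (u , w) → Incident x (u′ , w′) → (u , w) ≡ (u′ , w′)
    shared x∈f x∈g = label-injective f∈ g∈ x∈f x∈g (trans (sym (survivor-label x∈f f-surv)) (survivor-label x∈g g-surv))

  H-matching : IsMatching H
  H-matching = All.map valid H⊆⋃M , AllPairs-strengthen survivors-disjoint H-survivors
    (Unique.filter⁺ (survives? σ*) (deduplicate-! _≟ₑ_ (⋃ M)))
    where
    valid : ∀ {f} → f ∈ ⋃ M → ValidEdge f
    valid f∈ = let i , f∈Mᵢ = ∈-⋃⁻ M f∈ in All.lookup (proj₁ (M-matching i)) f∈Mᵢ

  kept≤∣H∩M∣ : ∀ i → kept σ* (M i) ≤ ∣ H ∩ M i ∣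
  kept≤∣H∩M∣ i = Unique⇒length-≤ (Unique.filter⁺ (survives? σ*) (AllPairs.map disjoint⇒≢ (proj₂ (M-matching i)))) kept⊆
    where
    disjoint⇒≢ : ∀ {f g : Edge n} → VertexDisjoint f g → f ≢ g
    disjoint⇒≢ (u≢u′ , _) refl = u≢u′ refl
    kept⊆ : ∀ {f} → f ∈ filter (survives? σ*) (M i) → f ∈ filter (_∈? M i) H
    kept⊆ f∈ = let f∈Mᵢ , surv = ∈-filter⁻ (survives? σ*) {xs = M i} f∈ in
      ∈-filter⁺ (_∈? M i) (∈-filter⁺ (survives? σ*) (∈-deduplicate⁺ _≟ₑ_ (∈-⋃ M i f∈Mᵢ)) surv) f∈Mᵢ

  finalWeight-≤ : ∀ i → finalWeight (kept σ* (M i)) (dropped σ* (M i)) ≤ k * mean ^ e (M i)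
  finalWeight-≤ i = *-cancelˡ-≤ (scale i) {{m^n≢0 mean (total ∸ e (M i))}} (begin
    scale i * finalWeight (kept σ* (M i)) (dropped σ* (M i))
      ≡⟨ cong (scale i *_) (matchingWeight-final σ* (M i)) ⟨
    scale i * matchingWeight (M i) n σ*
      ≤⟨ term-≤-sum (λ j → scale j * matchingWeight (M j) n σ*) i ⟩
    potential n σ*
      ≤⟨ proj₂ derandomised ⟩
    potential 0 (λ _ → 0)
      ≡⟨ potential-initial (λ _ → 0) ⟩
    k * mean ^ total
      ≡⟨ cong (k *_) (scale-spec i) ⟨
    k * (scale i * mean ^ e (M i))
      ≡⟨ x∙yz≈y∙xz k (scale i) (mean ^ e (M i)) ⟩
    scale i * (k * mean ^ e (M i)) ∎)
    where open ≤-Reasoning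

  dropped≤R*kept : ∀ {i} → LnBound (e (M i)) c k → dropped σ* (M i) ≤ R * kept σ* (M i)
  dropped≤R*kept {i} m>clnk = ≮⇒≥ (λ RTᵢ<Fᵢ → <-irrefl refl (begin-strict
    threshold ^ e (M i)        ≡⟨ cong (threshold ^_) (length-filter-∁ (survives? σ*) (M i)) ⟨
    threshold ^ (Tᵢ + Fᵢ)      ≤⟨ threshold≤finalWeight (<⇒≤ RTᵢ<Fᵢ) ⟩
    finalWeight Tᵢ Fᵢ ^ B           ≤⟨ ^-monoˡ-≤ B (finalWeight-≤ i) ⟩
    (k * mean ^ e (M i)) ^ B   <⟨ lnBound⇒[k*mean^m]^B<threshold^m {e (M i)} {k} m>clnk ⟩
    threshold ^ e (M i)        ∎))
    where
    open ≤-Reasoning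
    Tᵢ = kept σ* (M i)
    Fᵢ = dropped σ* (M i)

  e[M]≤B*∣H∩M∣ : ∀ {i} → LnBound (e (M i)) c k → e (M i) ≤ B * ∣ H ∩ M i ∣
  e[M]≤B*∣H∩M∣ {i} m>clnk = begin
    e (M i)                  ≡⟨ length-filter-∁ (survives? σ*) (M i) ⟨
    Tᵢ + dropped σ* (M i)    ≤⟨ +-monoʳ-≤ Tᵢ (dropped≤R*kept m>clnk) ⟩
    B * Tᵢ                   ≤⟨ *-monoʳ-≤ B (kept≤∣H∩M∣ i) ⟩
    B * ∣ H ∩ M i ∣          ∎
    where
    open ≤-Reasoning
    Tᵢ = kept σ* (M i)

lemma4p2 : (n k r : ℕ) (M : Vector (List (Edge n)) k) →
    ((i : Fin k) → IsMatching (M i)) →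
    MaxDegreeAtMost (⋃ M) r →
    ((i : Fin k) → LnBound (e (M i)) (2 * (r ^ 3 + r) ^ 2) k) →
    ∃[ H ] (IsMatching H × All (λ f → f ∈ ⋃ M) H ×
      ((i : Fin k) → e (M i) ≤ (r ^ 2 + 1) * ∣ H ∩ M i ∣))
lemma4p2 n k zero M _ maxDegree _ =
  [] , ([] , []) , [] , λ i → ≤-reflexive (maxDegree-zero maxDegree (All.tabulate (∈-⋃ M i)))
lemma4p2 n k (suc r′) M M-matching maxDegree m>clnk =
  H , H-matching , H⊆⋃M , λ i → subst (λ b → e (M i) ≤ b * ∣ H ∩ M i ∣) B≡r²+1 (e[M]≤B*∣H∩M∣ (m>clnk i))
  where
  open Rounding M r′ M-matching maxDegree
  open Weights r′ using (B)
  B≡r²+1 : B ≡ suc r′ ^ 2 + 1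
  B≡r²+1 = identity r′
    where
    identity : ∀ r′ → suc (suc (r′ * (suc r′ + 1))) ≡ suc r′ * (suc r′ * 1) + 1
    identity = solve-∀
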